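{- Let $k,\ell$ be positive odd integers with $\ell>k$, and let $n$ be a positive integer. If $n > p^3$ for some prime $p \mid n$, then $a_{k,\ell}(n) > 0$.
   Context: For positive integers $n$, define \[ a_{k,\ell}(n) := (n^{3\ell} + n^{2\ell} + n^{\ell} + 1)\,\sigma_{3k}(n) - (n^{3k} + n^{2k} + n^{k} + 1)\,\sigma_{3\ell}(n), \] where $\sigma_s(n)=\sum_{d\mid n}d^s$. -}

module Defs where

open import Data.Nat using (ℕ; suc; _+_; _*_; _^_)
open import Data.Nat.Divisibility using (_∣_; _∣?_)
open import Data.List using (List; filter; upTo; map)
open import Data.Nat.ListAction using (sum)
open import Data.Product using (∃)
open import Relation.Binary.PropositionalEquality using (_≡_)
open import Data.Integer using (ℤ; +_; _-_)
import Data.Integer as ℤ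

-- positive divisors of n (for n ≥ 1): d ∈ {0,…,n} with d ∣ n; d = 0 divides n only when n = 0
divisors : ℕ → List ℕ
divisors n = filter (_∣? n) (upTo (suc n))

σ : ℕ → ℕ → ℕ
σ s n = sum (map (λ d → d ^ s) (divisors n))

a : ℕ → ℕ → ℕ → ℤ
a k ℓ n =
  (+ ((n ^ (3 * ℓ) + n ^ (2 * ℓ) + n ^ ℓ + 1) * σ (3 * k) n))
  - (+ ((n ^ (3 * k) + n ^ (2 * k) + n ^ k + 1) * σ (3 * ℓ) n))

IsOdd : ℕ → Set
IsOdd n = ∃ λ m → n ≡ 2 * m + 1

-- Write ℓ = k + q with q ≥ 2, N = n^k, L = n^ℓ and G = geom₄, G(x) = 1 + x + x² + x³, so that the claim is
-- G(N) σ_{3ℓ}(n) < G(L) σ_{3k}(n); compare the two sums divisor by divisor.  A proper divisor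
-- d ≤ n/2 weighs less on the left, since G(N) ≤ 2N³ and 2 d^{3q} ≤ n^{3q}.  The divisor n weighs
-- more on the left, by about N² L³.  Writing n = m p with p² < m and M = m^k, the divisor m repays
-- this: it weighs about L³ M³ on the right, and M³ > N² = M² p^{2k}.  The margin
-- M ≥ (1 + 1/p²) p^{2k} also absorbs the lower-order terms because p^{3q} ≥ p⁶, which is where
-- q ≥ 2 (ℓ − k is even) is used.
module Submission where

open import Defs
open import Data.Nat using (ℕ; zero; suc; _+_; _*_; _∸_; _^_; _≤_; _<_; z≤n; s≤s; NonZero; >-nonZero; nonTrivial⇒n>1)
open import Data.Nat.Properties
open import Data.Nat.Divisibility using (_∣_; _∣?_; divides; ∣-refl; m∣m*n)
open import Data.Nat.Primality using (Prime; prime⇒nonTrivial)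
open import Data.Nat.ListAction using (sum)
open import Data.Nat.ListAction.Properties using (sum-++)
open import Data.Nat.Solver using (module +-*-Solver)
open import Data.Integer using (+_)
import Data.Integer as ℤ
import Data.Integer.Properties as ℤ
open import Data.List using (List; []; _∷_; _∷ʳ_; _++_; filter; upTo; map)
open import Data.List.Properties using (upTo-∷ʳ; filter-++; filter-accept; map-++)
open import Data.List.Membership.Propositional using (_∈_)
open import Data.List.Membership.Propositional.Properties using (∈-filter⁺; ∈-filter⁻; ∈-upTo⁺; ∈-upTo⁻)
open import Data.List.Relation.Unary.All as All using ()
open import Data.List.Relation.Unary.AllPairs using ([]; _∷_)
open import Data.List.Relation.Unary.Any using (here; there)
open import Data.List.Relation.Unary.Unique.Propositional using (Unique)
open import Data.List.Relation.Unary.Unique.Propositional.Properties using (filter⁺; upTo⁺)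
open import Data.Empty using (⊥-elim)
open import Data.Product using (∃; _×_; _,_; map₁)
open import Function using (_∘_)
open import Relation.Binary.PropositionalEquality

open +-*-Solver

geom₄ : ℕ → ℕ
geom₄ x = x ^ 3 + x ^ 2 + x + 1

*-distribˡ-sum-map : ∀ c (f : ℕ → ℕ) xs → c * sum (map f xs) ≡ sum (map (λ x → c * f x) xs)
*-distribˡ-sum-map c f []       = *-zeroʳ c
*-distribˡ-sum-map c f (x ∷ xs) =
  trans (*-distribˡ-+ c (f x) _) (cong (_+_ (c * f x)) (*-distribˡ-sum-map c f xs))

sum-map-∷ʳ : ∀ (f : ℕ → ℕ) xs y → sum (map f (xs ∷ʳ y)) ≡ sum (map f xs) + f y
sum-map-∷ʳ f xs y = begin
  sum (map f (xs ∷ʳ y))              ≡⟨ cong sum (map-++ f xs (y ∷ [])) ⟩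
  sum (map f xs ++ f y ∷ [])         ≡⟨ sum-++ (map f xs) (f y ∷ []) ⟩
  sum (map f xs) + (f y + 0)         ≡⟨ cong (_+_ (sum (map f xs))) (+-identityʳ (f y)) ⟩
  sum (map f xs) + f y               ∎
  where open ≡-Reasoning

sum-map-mono-≤ : ∀ {f g : ℕ → ℕ} xs → (∀ {x} → x ∈ xs → f x ≤ g x) →
                 sum (map f xs) ≤ sum (map g xs)
sum-map-mono-≤ []       _   = z≤n
sum-map-mono-≤ (x ∷ xs) f≤g = +-mono-≤ (f≤g (here refl)) (sum-map-mono-≤ xs (f≤g ∘ there))

sum-map-≤-except : ∀ {f g : ℕ → ℕ} {y xs} → Unique xs → y ∈ xs →
                   (∀ {x} → x ∈ xs → x ≢ y → f x ≤ g x) →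
                   sum (map f xs) + g y ≤ sum (map g xs) + f y
sum-map-≤-except {f} {g} {y} {y ∷ xs} (y∉xs ∷ _) (here refl) f≤g = begin
  f y + sum (map f xs) + g y  ≡⟨ solve 3 (λ a b c → a :+ b :+ c := c :+ b :+ a) refl (f y) _ (g y) ⟩
  g y + sum (map f xs) + f y  ≤⟨ +-monoˡ-≤ (f y) (+-monoʳ-≤ (g y) (sum-map-mono-≤ xs f≤g′)) ⟩
  g y + sum (map g xs) + f y  ∎
  where
  open ≤-Reasoning
  f≤g′ : ∀ {x} → x ∈ xs → f x ≤ g x
  f≤g′ x∈xs = f≤g (there x∈xs) (≢-sym (All.lookup y∉xs x∈xs))
sum-map-≤-except {f} {g} {y} {x ∷ xs} (x∉xs ∷ unique) (there y∈xs) f≤g = begin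
  f x + sum (map f xs) + g y    ≡⟨ +-assoc (f x) _ (g y) ⟩
  f x + (sum (map f xs) + g y)  ≤⟨ +-mono-≤ (f≤g (here refl) (All.lookup x∉xs y∈xs))
                                     (sum-map-≤-except unique y∈xs (f≤g ∘ there)) ⟩
  g x + (sum (map g xs) + f y)  ≡⟨ +-assoc (g x) _ (f y) ⟨
  g x + sum (map g xs) + f y    ∎
  where open ≤-Reasoning

sum-map-<-except₂ : ∀ {f g : ℕ → ℕ} {x y xs} → Unique xs → x ∈ xs →
                    (∀ {z} → z ∈ xs → z ≢ x → f z ≤ g z) → f x + f y < g x + g y →
                    sum (map f (xs ∷ʳ y)) < sum (map g (xs ∷ʳ y))
sum-map-<-except₂ {f} {g} {x} {y} {xs} unique x∈xs f≤g fxy<gxy =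
  subst₂ _<_ (sym (sum-map-∷ʳ f xs y)) (sym (sum-map-∷ʳ g xs y))
    (+-cancelʳ-< (g x + f x) _ _ (begin-strict
      Σf + f y + (g x + f x)    ≡⟨ solve 4 (λ a b c d → a :+ b :+ (c :+ d) := a :+ c :+ (d :+ b)) refl Σf (f y) (g x) (f x) ⟩
      Σf + g x + (f x + f y)    <⟨ +-mono-≤-< (sum-map-≤-except unique x∈xs f≤g) fxy<gxy ⟩
      Σg + f x + (g x + g y)    ≡⟨ solve 4 (λ a c d e → a :+ d :+ (c :+ e) := a :+ e :+ (c :+ d)) refl Σg (g x) (f x) (g y) ⟩
      Σg + g y + (g x + f x)    ∎))
  where
  open ≤-Reasoning
  Σf = sum (map f xs)
  Σg = sum (map g xs)

properDivisors : ℕ → List ℕ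
properDivisors n = filter (_∣? n) (upTo n)

divisors≡properDivisors∷ʳ : ∀ n → divisors n ≡ properDivisors n ∷ʳ n
divisors≡properDivisors∷ʳ n = begin
  filter (_∣? n) (upTo (suc n))                        ≡⟨ cong (filter (_∣? n)) (upTo-∷ʳ n) ⟨
  filter (_∣? n) (upTo n ∷ʳ n)                         ≡⟨ filter-++ (_∣? n) (upTo n) (n ∷ []) ⟩
  properDivisors n ++ filter (_∣? n) (n ∷ [])          ≡⟨ cong (properDivisors n ++_) (filter-accept (_∣? n) ∣-refl) ⟩
  properDivisors n ∷ʳ n                                ∎
  where open ≡-Reasoning

properDivisors-unique : ∀ n → Unique (properDivisors n)
properDivisors-unique n = filter⁺ (_∣? n) (upTo⁺ n)

∈-properDivisors⁺ : ∀ {d n} → d < n → d ∣ n → d ∈ properDivisors n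
∈-properDivisors⁺ {n = n} d<n d∣n = ∈-filter⁺ (_∣? n) (∈-upTo⁺ d<n) d∣n

∈-properDivisors⁻ : ∀ {d n} → d ∈ properDivisors n → d < n × d ∣ n
∈-properDivisors⁻ {n = n} = map₁ ∈-upTo⁻ ∘ ∈-filter⁻ (_∣? n)

∣∧<⇒2*≤ : ∀ {d n} → d ∣ n → d < n → 2 * d ≤ n
∣∧<⇒2*≤ (divides 0 refl)             ()
∣∧<⇒2*≤ {d} (divides 1 refl)         d<d+0 = ⊥-elim (<-irrefl (sym (+-identityʳ d)) d<d+0)
∣∧<⇒2*≤ {d} (divides (suc (suc c)) refl) _ = *-monoˡ-≤ d (s≤s (s≤s (z≤n {c})))

^-distribʳ-* : ∀ x y e → (x * y) ^ e ≡ x ^ e * y ^ e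
^-distribʳ-* x y zero    = refl
^-distribʳ-* x y (suc e) = begin
  x * y * (x * y) ^ e      ≡⟨ cong (_*_ (x * y)) (^-distribʳ-* x y e) ⟩
  x * y * (x ^ e * y ^ e)  ≡⟨ solve 4 (λ x y a b → x :* y :* (a :* b) := x :* a :* (y :* b)) refl x y (x ^ e) (y ^ e) ⟩
  x * x ^ e * (y * y ^ e)  ∎
  where open ≡-Reasoning

^-*-comm : ∀ x c e → x ^ (c * e) ≡ (x ^ e) ^ c
^-*-comm x c e = trans (cong (x ^_) (*-comm c e)) (sym (^-*-assoc x e c))

m≤m^n : ∀ m {n} → .{{NonZero m}} → 1 ≤ n → m ≤ m ^ n
m≤m^n m {n} 1≤n = subst (_≤ m ^ n) (*-identityʳ m) (^-monoʳ-≤ m 1≤n)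

geom₄-^ : ∀ x e → x ^ (3 * e) + x ^ (2 * e) + x ^ e + 1 ≡ geom₄ (x ^ e)
geom₄-^ x e = cong₂ (λ a b → a + b + x ^ e + 1) (^-*-comm x 3 e) (^-*-comm x 2 e)

^3<geom₄ : ∀ x → x ^ 3 < geom₄ x
^3<geom₄ x = subst (x ^ 3 <_) (+-comm 1 _) (s≤s (≤-trans (m≤m+n _ _) (m≤m+n _ _)))

geom₄≤2*^3 : ∀ {x} → 2 ≤ x → geom₄ x ≤ 2 * x ^ 3
geom₄≤2*^3 {x} 2≤x = begin
  geom₄ x                    ≡⟨ solve 1 (λ x → x :^ 3 :+ x :^ 2 :+ x :+ con 1 := x :^ 3 :+ (x :* x :+ (x :+ con 1))) refl x ⟩
  x ^ 3 + (x * x + (x + 1))  ≤⟨ +-monoʳ-≤ (x ^ 3) (+-monoʳ-≤ (x * x) x+1≤x*x) ⟩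
  x ^ 3 + (x * x + x * x)    ≡⟨ cong (_+_ (x ^ 3)) (solve 1 (λ x → x :* x :+ x :* x := con 2 :* (x :* x)) refl x) ⟩
  x ^ 3 + 2 * (x * x)        ≤⟨ +-monoʳ-≤ (x ^ 3) (*-monoˡ-≤ (x * x) 2≤x) ⟩
  x ^ 3 + x * (x * x)        ≡⟨ solve 1 (λ x → x :^ 3 :+ x :* (x :* x) := con 2 :* x :^ 3) refl x ⟩
  2 * x ^ 3                  ∎
  where
  open ≤-Reasoning
  x+1≤x*x : x + 1 ≤ x * x
  x+1≤x*x = begin
    x + 1      ≤⟨ +-monoʳ-≤ x (≤-trans (s≤s z≤n) 2≤x) ⟩
    x + x      ≡⟨ solve 1 (λ x → x :+ x := con 2 :* x) refl x ⟩
    2 * x      ≤⟨ *-monoˡ-≤ x 2≤x ⟩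
    x * x      ∎

geom₄*z≤geom₄[x*y] : ∀ {x y z} → 2 ≤ x → 2 * z ≤ y ^ 3 → geom₄ x * z ≤ geom₄ (x * y)
geom₄*z≤geom₄[x*y] {x} {y} {z} 2≤x 2z≤y³ = begin
  geom₄ x * z      ≤⟨ *-monoˡ-≤ z (geom₄≤2*^3 2≤x) ⟩
  2 * x ^ 3 * z    ≡⟨ solve 2 (λ a z → con 2 :* a :* z := a :* (con 2 :* z)) refl (x ^ 3) z ⟩
  x ^ 3 * (2 * z)  ≤⟨ *-monoʳ-≤ (x ^ 3) 2z≤y³ ⟩
  x ^ 3 * y ^ 3    ≡⟨ ^-distribʳ-* x y 3 ⟨
  (x * y) ^ 3      ≤⟨ <⇒≤ (^3<geom₄ (x * y)) ⟩
  geom₄ (x * y)    ∎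
  where open ≤-Reasoning

geom₄-weight-≤ : ∀ {n d} k q → 2 ≤ n → 2 * d ≤ n → 1 ≤ k → 1 ≤ q →
                 geom₄ (n ^ k) * d ^ (3 * (k + q)) ≤ geom₄ (n ^ (k + q)) * d ^ (3 * k)
geom₄-weight-≤ {n} {d} k q 2≤n 2d≤n 1≤k 1≤q = begin
  geom₄ (n ^ k) * d ^ (3 * (k + q))              ≡⟨ cong (_*_ (geom₄ (n ^ k))) d^[3k+3q] ⟩
  geom₄ (n ^ k) * (d ^ (3 * k) * (d ^ q) ^ 3)    ≡⟨ solve 3 (λ a b c → a :* (b :* c) := a :* c :* b) refl (geom₄ (n ^ k)) _ _ ⟩
  geom₄ (n ^ k) * (d ^ q) ^ 3 * d ^ (3 * k)      ≤⟨ *-monoˡ-≤ (d ^ (3 * k)) (geom₄*z≤geom₄[x*y] 2≤nᵏ 2*[dᵠ]³≤[nᵠ]³) ⟩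
  geom₄ (n ^ k * n ^ q) * d ^ (3 * k)            ≡⟨ cong (λ x → geom₄ x * d ^ (3 * k)) (^-distribˡ-+-* n k q) ⟨
  geom₄ (n ^ (k + q)) * d ^ (3 * k)              ∎
  where
  open ≤-Reasoning
  instance
    n≢0 : NonZero n
    n≢0 = >-nonZero (≤-trans (s≤s z≤n) 2≤n)
  d^[3k+3q] : d ^ (3 * (k + q)) ≡ d ^ (3 * k) * (d ^ q) ^ 3
  d^[3k+3q] = begin-equality
    d ^ (3 * (k + q))            ≡⟨ cong (d ^_) (*-distribˡ-+ 3 k q) ⟩
    d ^ (3 * k + 3 * q)          ≡⟨ ^-distribˡ-+-* d (3 * k) (3 * q) ⟩
    d ^ (3 * k) * d ^ (3 * q)    ≡⟨ cong (_*_ (d ^ (3 * k))) (^-*-comm d 3 q) ⟩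
    d ^ (3 * k) * (d ^ q) ^ 3    ∎
  2≤nᵏ : 2 ≤ n ^ k
  2≤nᵏ = ≤-trans 2≤n (m≤m^n n 1≤k)
  2*dᵠ≤nᵠ : 2 * d ^ q ≤ n ^ q
  2*dᵠ≤nᵠ = begin
    2 * d ^ q      ≤⟨ *-monoˡ-≤ (d ^ q) (m≤m^n 2 1≤q) ⟩
    2 ^ q * d ^ q  ≡⟨ ^-distribʳ-* 2 d q ⟨
    (2 * d) ^ q    ≤⟨ ^-monoˡ-≤ q 2d≤n ⟩
    n ^ q          ∎
  2*[dᵠ]³≤[nᵠ]³ : 2 * (d ^ q) ^ 3 ≤ (n ^ q) ^ 3
  2*[dᵠ]³≤[nᵠ]³ = begin
    2 * (d ^ q) ^ 3    ≤⟨ *-monoˡ-≤ ((d ^ q) ^ 3) (s≤s (s≤s (z≤n {6}))) ⟩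
    8 * (d ^ q) ^ 3    ≡⟨ solve 1 (λ x → con 8 :* x :^ 3 := (con 2 :* x) :^ 3) refl (d ^ q) ⟩
    (2 * d ^ q) ^ 3    ≤⟨ ^-monoˡ-≤ 3 2*dᵠ≤nᵠ ⟩
    (n ^ q) ^ 3        ∎

geom₄-exchange-< : ∀ N K V M → .{{NonZero M}} →
                   (N ^ 2 + N + 1) * K ^ 3 + geom₄ N ≤ K ^ 3 * M ^ 3 →
                   geom₄ N * (V ^ 3 + (V * K) ^ 3) < geom₄ (V * K) * (M ^ 3 + N ^ 3)
geom₄-exchange-< N K V M premise = begin-strict
  geom₄ N * (V ^ 3 + (V * K) ^ 3)
    ≡⟨ solve 3 (λ N K V → (N :^ 3 :+ N :^ 2 :+ N :+ con 1) :* (V :^ 3 :+ (V :* K) :^ 3)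
                        := N :^ 3 :* (V :* K) :^ 3 :+ V :^ 3 :* ((N :^ 2 :+ N :+ con 1) :* K :^ 3 :+ (N :^ 3 :+ N :^ 2 :+ N :+ con 1)))
               refl N K V ⟩
  N ^ 3 * (V * K) ^ 3 + V ^ 3 * ((N ^ 2 + N + 1) * K ^ 3 + geom₄ N)
    ≤⟨ +-monoʳ-≤ (N ^ 3 * (V * K) ^ 3) (*-monoʳ-≤ (V ^ 3) premise) ⟩
  N ^ 3 * (V * K) ^ 3 + V ^ 3 * (K ^ 3 * M ^ 3)
    ≡⟨ solve 4 (λ N K V M → N :^ 3 :* (V :* K) :^ 3 :+ V :^ 3 :* (K :^ 3 :* M :^ 3) := (V :* K) :^ 3 :* (M :^ 3 :+ N :^ 3)) refl N K V M ⟩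
  (V * K) ^ 3 * (M ^ 3 + N ^ 3)
    <⟨ *-monoˡ-< (M ^ 3 + N ^ 3) (^3<geom₄ (V * K)) ⟩
  geom₄ (V * K) * (M ^ 3 + N ^ 3)  ∎
  where
  open ≤-Reasoning
  instance
    M³+N³≢0 : NonZero (M ^ 3 + N ^ 3)
    M³+N³≢0 = >-nonZero (≤-trans (m^n>0 M 3) (m≤m+n (M ^ 3) (N ^ 3)))

-- Avoiding subtraction: N² + N + 1 ≤ (1 − 1/(2(A+1))) M³ for N = M P.
geom₄-tail-≤ : ∀ {A P M} → 2 ≤ P → suc A ≤ M → suc A * P ^ 2 ≤ A * M →
               2 * suc A * ((M * P) ^ 2 + M * P + 1) + M ^ 3 ≤ 2 * suc A * M ^ 3
geom₄-tail-≤ {A} {P} {M} 2≤P 1+A≤M [1+A]P²≤AM = begin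
  2 * c * ((M * P) ^ 2 + M * P + 1) + M ^ 3
    ≡⟨ solve 4 (λ c M P M³ → con 2 :* c :* ((M :* P) :^ 2 :+ M :* P :+ con 1) :+ M³
                          := con 2 :* (c :* P :^ 2 :* M :^ 2) :+ (c :* (con 2 :* (M :* P :+ con 1)) :+ M³))
               refl c M P (M ^ 3) ⟩
  2 * (c * P ^ 2 * M ^ 2) + (c * (2 * (M * P + 1)) + M ^ 3)
    ≤⟨ +-mono-≤ (*-monoʳ-≤ 2 (*-monoˡ-≤ (M ^ 2) [1+A]P²≤AM)) (+-monoˡ-≤ (M ^ 3) (*-mono-≤ 1+A≤M 2[MP+1]≤M²)) ⟩
  2 * (A * M * M ^ 2) + (M * M ^ 2 + M ^ 3)
    ≡⟨ solve 2 (λ A M → con 2 :* (A :* M :* M :^ 2) :+ (M :* M :^ 2 :+ M :^ 3) := con 2 :* (con 1 :+ A) :* M :^ 3) refl A M ⟩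
  2 * c * M ^ 3  ∎
  where
  open ≤-Reasoning
  c = suc A
  instance
    M≢0 : NonZero M
    M≢0 = >-nonZero (≤-trans (s≤s z≤n) 1+A≤M)
  P²<M : P ^ 2 < M
  P²<M = *-cancelˡ-< c (P ^ 2) M (≤-<-trans [1+A]P²≤AM (*-monoˡ-< M (n<1+n A)))
  2[MP+1]≤M² : 2 * (M * P + 1) ≤ M ^ 2
  2[MP+1]≤M² = begin
    2 * (M * P + 1)      ≡⟨ solve 2 (λ M P → con 2 :* (M :* P :+ con 1) := M :* (con 2 :* P) :+ con 2) refl M P ⟩
    M * (2 * P) + 2      ≤⟨ +-mono-≤ (*-monoʳ-≤ M 2P≤P²) 2≤M ⟩
    M * P ^ 2 + M        ≡⟨ solve 2 (λ M P → M :* P :^ 2 :+ M := M :* (con 1 :+ P :^ 2)) refl M P ⟩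
    M * suc (P ^ 2)      ≤⟨ *-monoʳ-≤ M P²<M ⟩
    M * M                ≡⟨ solve 1 (λ M → M :* M := M :^ 2) refl M ⟩
    M ^ 2                ∎
    where
    2P≤P² : 2 * P ≤ P ^ 2
    2P≤P² = ≤-trans (*-monoˡ-≤ P 2≤P) (≤-reflexive (solve 1 (λ P → P :* P := P :^ 2) refl P))
    2≤M : 2 ≤ M
    2≤M = ≤-trans (≤-trans (m≤m*n 2 P {{>-nonZero (≤-trans (s≤s z≤n) 2≤P)}}) 2P≤P²) (<⇒≤ P²<M)

geom₄-exchange-premise : ∀ {A P M u} → 2 ≤ P → suc A ≤ M → suc A * P ^ 2 ≤ A * M → 4 * suc A ≤ u ^ 3 →
                         ((M * P) ^ 2 + M * P + 1) * (P * u) ^ 3 + geom₄ (M * P) ≤ (P * u) ^ 3 * M ^ 3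
geom₄-exchange-premise {A} {P} {M} {u} 2≤P 1+A≤M [1+A]P²≤AM 4[1+A]≤u³ = *-cancelˡ-≤ (2 * c) (begin
  2 * c * (T * (P * u) ^ 3 + geom₄ N)
    ≡⟨ solve 4 (λ c T K G → con 2 :* c :* (T :* K :+ G) := con 2 :* c :* T :* K :+ con 2 :* c :* G) refl c T ((P * u) ^ 3) (geom₄ N) ⟩
  2 * c * T * (P * u) ^ 3 + 2 * c * geom₄ N
    ≤⟨ +-monoʳ-≤ (2 * c * T * (P * u) ^ 3) (*-monoʳ-≤ (2 * c) (geom₄≤2*^3 2≤N)) ⟩
  2 * c * T * (P * u) ^ 3 + 2 * c * (2 * N ^ 3)
    ≡⟨ cong (_+_ (2 * c * T * (P * u) ^ 3)) (solve 3 (λ c M P → con 2 :* c :* (con 2 :* (M :* P) :^ 3) := con 4 :* c :* (P :^ 3 :* M :^ 3)) refl c M P) ⟩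
  2 * c * T * (P * u) ^ 3 + 4 * c * (P ^ 3 * M ^ 3)
    ≤⟨ +-monoʳ-≤ (2 * c * T * (P * u) ^ 3) (*-monoˡ-≤ (P ^ 3 * M ^ 3) 4[1+A]≤u³) ⟩
  2 * c * T * (P * u) ^ 3 + u ^ 3 * (P ^ 3 * M ^ 3)
    ≡⟨ solve 4 (λ X P u M → X :* (P :* u) :^ 3 :+ u :^ 3 :* (P :^ 3 :* M :^ 3) := (X :+ M :^ 3) :* (P :* u) :^ 3) refl (2 * c * T) P u M ⟩
  (2 * c * T + M ^ 3) * (P * u) ^ 3
    ≤⟨ *-monoˡ-≤ ((P * u) ^ 3) (geom₄-tail-≤ 2≤P 1+A≤M [1+A]P²≤AM) ⟩
  2 * c * M ^ 3 * (P * u) ^ 3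
    ≡⟨ solve 3 (λ X M K → X :* M :* K := X :* (K :* M)) refl (2 * c) (M ^ 3) ((P * u) ^ 3) ⟩
  2 * c * ((P * u) ^ 3 * M ^ 3)  ∎)
  where
  open ≤-Reasoning
  c = suc A
  N = M * P
  T = N ^ 2 + N + 1
  2≤N : 2 ≤ N
  2≤N = ≤-trans 2≤P (m≤n*m P M {{>-nonZero (≤-trans (s≤s z≤n) 1+A≤M)}})

[1+a]*a^k≤a*m^k : ∀ {a m} k → suc a ≤ m → 1 ≤ k → suc a * a ^ k ≤ a * m ^ k
[1+a]*a^k≤a*m^k {a} {m} 1 1+a≤m _ = begin
  suc a * a ^ 1  ≡⟨ solve 1 (λ a → (con 1 :+ a) :* a :^ 1 := a :* (con 1 :+ a)) refl a ⟩
  a * suc a      ≤⟨ *-monoʳ-≤ a 1+a≤m ⟩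
  a * m          ≡⟨ cong (_*_ a) (*-identityʳ m) ⟨
  a * m ^ 1      ∎
  where open ≤-Reasoning
[1+a]*a^k≤a*m^k {a} {m} (suc (suc k)) 1+a≤m _ = begin
  suc a * (a * a ^ suc k)  ≡⟨ solve 3 (λ c a x → c :* (a :* x) := a :* (c :* x)) refl (suc a) a (a ^ suc k) ⟩
  a * (suc a * a ^ suc k)  ≤⟨ *-monoʳ-≤ a ([1+a]*a^k≤a*m^k (suc k) 1+a≤m (s≤s z≤n)) ⟩
  a * (a * m ^ suc k)      ≤⟨ *-monoʳ-≤ a (*-monoˡ-≤ (m ^ suc k) (<⇒≤ 1+a≤m)) ⟩
  a * (m * m ^ suc k)      ∎
  where open ≤-Reasoning

4*[1+a]≤a^3 : ∀ {a} → 4 ≤ a → 4 * suc a ≤ a ^ 3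
4*[1+a]≤a^3 {a} 4≤a = begin
  4 * suc a    ≡⟨ solve 1 (λ a → con 4 :* (con 1 :+ a) := con 4 :+ con 4 :* a) refl a ⟩
  4 + 4 * a    ≤⟨ +-monoˡ-≤ (4 * a) 4≤a ⟩
  a + 4 * a    ≡⟨ solve 1 (λ a → a :+ con 4 :* a := con 5 :* a) refl a ⟩
  5 * a        ≤⟨ *-monoˡ-≤ a (≤-trans (m≤m+n 5 11) (*-mono-≤ 4≤a 4≤a)) ⟩
  a * a * a    ≡⟨ solve 1 (λ a → a :* a :* a := a :^ 3) refl a ⟩
  a ^ 3        ∎
  where open ≤-Reasoning

geom₄-weight-pair-< : ∀ {p m} k q → 2 ≤ p → p ^ 2 < m → 1 ≤ k → 2 ≤ q →
  let n = m * p; ℓ = k + q in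
  geom₄ (n ^ k) * m ^ (3 * ℓ) + geom₄ (n ^ k) * n ^ (3 * ℓ) <
  geom₄ (n ^ ℓ) * m ^ (3 * k) + geom₄ (n ^ ℓ) * n ^ (3 * k)
geom₄-weight-pair-< {p} {m} k q 2≤p p²<m 1≤k 2≤q = begin-strict
  geom₄ (n ^ k) * m ^ (3 * ℓ) + geom₄ (n ^ k) * n ^ (3 * ℓ)
    ≡⟨ *-distribˡ-+ (geom₄ (n ^ k)) _ _ ⟨
  geom₄ (n ^ k) * (m ^ (3 * ℓ) + n ^ (3 * ℓ))
    ≡⟨ cong₂ (λ x y → geom₄ x * y) nᵏ (cong₂ _+_ (^-*-comm m 3 ℓ) (trans (^-*-comm n 3 ℓ) (cong (_^ 3) nˡ))) ⟩
  geom₄ (M * P) * (V ^ 3 + (V * (P * u)) ^ 3)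
    <⟨ geom₄-exchange-< (M * P) (P * u) V M
         (geom₄-exchange-premise 2≤P 1+p²≤M [1+p²]P²≤p²M 4[1+p²]≤u³) ⟩
  geom₄ (V * (P * u)) * (M ^ 3 + (M * P) ^ 3)
    ≡⟨ cong₂ (λ x y → geom₄ x * y) nˡ (cong₂ _+_ (^-*-comm m 3 k) (trans (^-*-comm n 3 k) (cong (_^ 3) nᵏ))) ⟨
  geom₄ (n ^ ℓ) * (m ^ (3 * k) + n ^ (3 * k))
    ≡⟨ *-distribˡ-+ (geom₄ (n ^ ℓ)) _ _ ⟩
  geom₄ (n ^ ℓ) * m ^ (3 * k) + geom₄ (n ^ ℓ) * n ^ (3 * k)  ∎
  where
  open ≤-Reasoning
  n = m * p
  ℓ = k + q
  P = p ^ k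
  M = m ^ k
  u = p ^ q
  V = m ^ ℓ
  instance
    p≢0 : NonZero p
    p≢0 = >-nonZero (≤-trans (s≤s z≤n) 2≤p)
    m≢0 : NonZero m
    m≢0 = >-nonZero (≤-trans (s≤s z≤n) p²<m)
    M≢0 : NonZero M
    M≢0 = m^n≢0 m k
  nᵏ : n ^ k ≡ M * P
  nᵏ = ^-distribʳ-* m p k
  nˡ : n ^ ℓ ≡ V * (P * u)
  nˡ = trans (^-distribʳ-* m p ℓ) (cong (_*_ V) (^-distribˡ-+-* p k q))
  2≤P : 2 ≤ P
  2≤P = ≤-trans 2≤p (m≤m^n p 1≤k)
  1+p²≤M : suc (p ^ 2) ≤ M
  1+p²≤M = ≤-trans p²<m (m≤m^n m 1≤k)
  [1+p²]P²≤p²M : suc (p ^ 2) * P ^ 2 ≤ p ^ 2 * M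
  [1+p²]P²≤p²M = subst (λ x → suc (p ^ 2) * x ≤ p ^ 2 * M)
    (trans (^-*-assoc p 2 k) (^-*-comm p 2 k)) ([1+a]*a^k≤a*m^k k p²<m 1≤k)
  4[1+p²]≤u³ : 4 * suc (p ^ 2) ≤ u ^ 3
  4[1+p²]≤u³ = ≤-trans (4*[1+a]≤a^3 (^-monoˡ-≤ 2 2≤p)) (^-monoˡ-≤ 3 (^-monoʳ-≤ p 2≤q))

*-σ≡sum-map : ∀ c s n → c * σ s n ≡ sum (map (λ d → c * d ^ s) (properDivisors n ∷ʳ n))
*-σ≡sum-map c s n = trans (*-distribˡ-sum-map c (_^ s) (divisors n))
                          (cong (sum ∘ map (λ d → c * d ^ s)) (divisors≡properDivisors∷ʳ n))

geom₄-σ-< : ∀ {p m} k q → 2 ≤ p → p ^ 2 < m → 1 ≤ k → 2 ≤ q →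
  let n = m * p; ℓ = k + q in
  geom₄ (n ^ k) * σ (3 * ℓ) n < geom₄ (n ^ ℓ) * σ (3 * k) n
geom₄-σ-< {p} {m} k q 2≤p p²<m 1≤k 2≤q = begin-strict
  geom₄ (n ^ k) * σ (3 * ℓ) n          ≡⟨ *-σ≡sum-map (geom₄ (n ^ k)) (3 * ℓ) n ⟩
  sum (map f (properDivisors n ∷ʳ n))  <⟨ sum-map-<-except₂ (properDivisors-unique n) m∈properDivisors f≤g
                                            (geom₄-weight-pair-< k q 2≤p p²<m 1≤k 2≤q) ⟩
  sum (map g (properDivisors n ∷ʳ n))  ≡⟨ *-σ≡sum-map (geom₄ (n ^ ℓ)) (3 * k) n ⟨
  geom₄ (n ^ ℓ) * σ (3 * k) n          ∎
  where
  open ≤-Reasoning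
  n = m * p
  ℓ = k + q
  f g : ℕ → ℕ
  f d = geom₄ (n ^ k) * d ^ (3 * ℓ)
  g d = geom₄ (n ^ ℓ) * d ^ (3 * k)
  instance
    m≢0 : NonZero m
    m≢0 = >-nonZero (≤-trans (s≤s z≤n) p²<m)
  m∈properDivisors : m ∈ properDivisors n
  m∈properDivisors = ∈-properDivisors⁺ (m<m*n m p 2≤p) (m∣m*n p)
  2≤n : 2 ≤ n
  2≤n = ≤-trans 2≤p (m≤n*m p m)
  f≤g : ∀ {d} → d ∈ properDivisors n → d ≢ m → f d ≤ g d
  f≤g d∈properDivisors _ with d<n , d∣n ← ∈-properDivisors⁻ d∈properDivisors =
    geom₄-weight-≤ k q 2≤n (∣∧<⇒2*≤ d∣n d<n) 1≤k (≤-trans (s≤s z≤n) 2≤q)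

odd-gap : ∀ {k ℓ} → IsOdd k → IsOdd ℓ → k < ℓ → ∃ λ q → ℓ ≡ k + q × 2 ≤ q
odd-gap (i , refl) (j , refl) k<ℓ = 2 * (j ∸ i) , ℓ≡k+q , *-monoʳ-≤ 2 (m<n⇒0<n∸m i<j)
  where
  open ≡-Reasoning
  i<j : i < j
  i<j = *-cancelˡ-< 2 i j (+-cancelʳ-< 1 (2 * i) (2 * j) k<ℓ)
  ℓ≡k+q : 2 * j + 1 ≡ 2 * i + 1 + 2 * (j ∸ i)
  ℓ≡k+q = begin
    2 * j + 1                ≡⟨ cong (λ x → 2 * x + 1) (m+[n∸m]≡n (<⇒≤ i<j)) ⟨
    2 * (i + (j ∸ i)) + 1    ≡⟨ solve 2 (λ i t → con 2 :* (i :+ t) :+ con 1 := con 2 :* i :+ con 1 :+ con 2 :* t) refl i (j ∸ i) ⟩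
    2 * i + 1 + 2 * (j ∸ i)  ∎

0<[+m]-[+n] : ∀ {m n} → n < m → + 0 ℤ.< + m ℤ.- + n
0<[+m]-[+n] {m} {n} n<m = subst₂ ℤ._<_ (ℤ.n⊖n≡0 n) (sym (ℤ.[+m]-[+n]≡m⊖n m n)) (ℤ.⊖-monoˡ-< n n<m)

lemma3p4 : (k ℓ n : ℕ) → 0 < k → IsOdd k → IsOdd ℓ → k < ℓ → 0 < n →
    (∃ λ p → Prime p × p ∣ n × p ^ 3 < n) →
    (+ 0) ℤ.< a k ℓ n
lemma3p4 k ℓ n 1≤k k-odd ℓ-odd k<ℓ _ (p , p-prime , divides m refl , p³<mp)
  with q , refl , 2≤q ← odd-gap k-odd ℓ-odd k<ℓ =
  subst₂ (λ x y → + 0 ℤ.< + (x * σ (3 * k) (m * p)) ℤ.- + (y * σ (3 * (k + q)) (m * p)))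
         (sym (geom₄-^ (m * p) (k + q))) (sym (geom₄-^ (m * p) k))
         (0<[+m]-[+n] (geom₄-σ-< k q 2≤p p²<m 1≤k 2≤q))
  where
  2≤p : 2 ≤ p
  2≤p = nonTrivial⇒n>1 p {{prime⇒nonTrivial p-prime}}
  p²<m : p ^ 2 < m
  p²<m = *-cancelʳ-< p (p ^ 2) m
           (subst (_< m * p) (solve 1 (λ p → p :^ 3 := p :^ 2 :* p) refl p) p³<mp)
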